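{- For any $n,a,b\in\mathbb{N}$ satisfying $a\geq b$, we have that \begin{equation} i(P(n,a,b))=U_{n+2}(a,-b), \end{equation} and that \begin{equation} i(C(n,a,b))=V_n(a,-b). \end{equation}
   Context: For a graph $G$, a set $S$ of vertices is an independent set if no two vertices of $S$ are adjacent; $i(G)$ denotes the total number of independent sets of $G$ (including the empty set). For $n,a,b\in\mathbb{N}$ with $a\geq b$, the chainsaw graph $C(n,a,b)$ is built as follows: create an $n$-vertex cycle with vertex set $\mathbb{Z}_n$ (the $1$-vertex cycle being a vertex with a loop, the $2$-vertex cycle a single edge); for each vertex of the cycle, create an $a$-vertex complete graph sharing with the cycle only this vertex; then, for each $v\in\mathbb{Z}_n$, make vertex $v$ adjacent to $a-b$ additional vertices of the complete graph containing vertex $v+1 \pmod n$. The $n$ cycle vertices are called chain vertices and the rest blade vertices. The broken chainsaw $P(n,a,b)$ is obtained from $C(n+1,a,b)$ by removing one chain vertex (e.g. vertex $0$) and all edges adjacent to it. The Lucas sequences are $U_0(a,b)=0$, $U_1(a,b)=1$, $U_n(a,b)=aU_{n-1}(a,b)-bU_{n-2}(a,b)$ for $n>1$, and $V_0(a,b)=2$, $V_1(a,b)=a$, $V_n(a,b)=aV_{n-1}(a,b)-bV_{n-2}(a,b)$ for $n>1$. -}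

module Defs where

open import Data.Bool using (Bool; true; false; _∧_; _∨_; not; if_then_else_)
open import Data.Nat using (ℕ; zero; suc; _∸_; _≡ᵇ_; _≤ᵇ_)
open import Data.Integer using (ℤ; +_; _-_; _*_)
open import Data.List using (List; []; _∷_; map; _++_; upTo; cartesianProduct; filter)
open import Data.Product using (_×_; _,_)

-- Finite (simple, possibly looped) graphs given by an explicit
-- duplicate-free list of vertices and a Boolean adjacency relation.

record Graph : Set₁ where
  field
    V        : Set
    vertices : List V
    adj      : V → V → Bool
open Graph public

subsets : {A : Set} → List A → List (List A)
subsets []       = [] ∷ []
subsets (x ∷ xs) = map (x ∷_) (subsets xs) ++ subsets xs

allB : {A : Set} → (A → Bool) → List A → Bool
allB p []       = true
allB p (x ∷ xs) = p x ∧ allB p xs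

-- S is independent iff no two (not necessarily distinct) vertices of S
-- are adjacent (so a looped vertex never lies in an independent set)
isIndependent : (G : Graph) → List (V G) → Bool
isIndependent G S = allB (λ u → allB (λ v → not (adj G u v)) S) S

countTrue : {A : Set} → (A → Bool) → List A → ℕ
countTrue p []       = 0
countTrue p (x ∷ xs) = if p x then suc (countTrue p xs) else countTrue p xs

i : Graph → ℕ
i G = countTrue (isIndependent G) (subsets (vertices G))

-- Vertex (v , k) with v < n, k < a:
--   (v , 0)        is the chain vertex v of the cycle Z_n,
--   (v , k), k ≥ 1 are the a-1 blade vertices of the a-clique of v.
-- Chain vertex v is adjacent to the a-b blade vertices (v+1 , k),
-- 1 ≤ k ≤ a-b, of the clique of v+1 (mod n).

sucMod : ℕ → ℕ → ℕ
sucMod n v = if suc v ≡ᵇ n then 0 else suc v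

chainsawAdj : ℕ → ℕ → ℕ → ℕ × ℕ → ℕ × ℕ → Bool
chainsawAdj n a b (u , k) (v , l) =
     ((u ≡ᵇ v) ∧ not (k ≡ᵇ l))
     -- cycle edges (a loop if n = 1, a single edge if n = 2)
  ∨  ((k ≡ᵇ 0) ∧ (l ≡ᵇ 0) ∧ ((v ≡ᵇ sucMod n u) ∨ (u ≡ᵇ sucMod n v)))
  ∨  ((k ≡ᵇ 0) ∧ (1 ≤ᵇ l) ∧ (l ≤ᵇ (a ∸ b)) ∧ (v ≡ᵇ sucMod n u))
  ∨  ((l ≡ᵇ 0) ∧ (1 ≤ᵇ k) ∧ (k ≤ᵇ (a ∸ b)) ∧ (u ≡ᵇ sucMod n v))

chainsawVertices : ℕ → ℕ → List (ℕ × ℕ)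
chainsawVertices n a = cartesianProduct (upTo n) (upTo a)

C : ℕ → ℕ → ℕ → Graph
C n a b = record
  { V        = ℕ × ℕ
  ; vertices = chainsawVertices n a
  ; adj      = chainsawAdj n a b
  }

isChain0 : ℕ × ℕ → Bool
isChain0 (v , k) = (v ≡ᵇ 0) ∧ (k ≡ᵇ 0)

P : ℕ → ℕ → ℕ → Graph
P n a b = record
  { V        = ℕ × ℕ
  ; vertices = filter (λ x → not (isChain0 x) Data.Bool.≟ true) (chainsawVertices (suc n) a)
  ; adj      = chainsawAdj (suc n) a b
  }

U : ℕ → ℤ → ℤ → ℤ
U zero          a b = + 0
U (suc zero)    a b = + 1
U (suc (suc n)) a b = a * U (suc n) a b - b * U n a b

V' : ℕ → ℤ → ℤ → ℤ
V' zero          a b = + 2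
V' (suc zero)    a b = a
V' (suc (suc n)) a b = a * V' (suc n) a b - b * V' n a b

-- Order the vertices clique by clique along the chain. An independent set meets each clique in
-- at most one vertex, and the only edges between different cliques join chain vertex v to clique
-- v + 1 (cyclically). Let f k (resp. g k) count the independent sets of k consecutive cliques when
-- the chain vertex in front of them is not (resp. is) chosen. If it is chosen, the next chain
-- vertex and the a - b blade vertices adjacent to it are excluded, so g k = b · f (k - 1);
-- otherwise f k = g (k - 1) + a · f (k - 1). Hence f k = a · f (k - 1) + b · f (k - 2), the
-- recursion of U_k(a, -b). For the cycle, what is chosen in clique 0 additionally constrains the
-- last chain vertex, and the total becomes U_(n+1) + b · U_(n-1) = V_n.
module Submission where

open import Algebra.Bundles using (CommutativeMonoid)
open import Data.Bool using (Bool; true; false; T; _∧_; _∨_; not; if_then_else_)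
import Data.Bool as Bool
open import Data.Bool.Properties using (∧-zeroʳ; ∧-identityʳ; ∧-comm; ∨-identityʳ; ∨-idem; ∧-commutativeMonoid; T-≡)
open import Algebra.Properties.CommutativeSemigroup (CommutativeMonoid.commutativeSemigroup ∧-commutativeMonoid)
  using () renaming (interchange to ∧-interchange)
open import Data.Empty using (⊥-elim)
open import Data.Integer using (+_; -_)
import Data.Integer as ℤ
import Data.Integer.Properties as ℤ
open import Data.List using (List; []; _∷_; map; _++_; filter; applyUpTo; upTo; cartesianProductWith)
open import Data.List.Properties using (filter-++; filter-all)
open import Data.List.Relation.Unary.All as All using (All; []; _∷_)
open import Data.List.Relation.Unary.All.Properties using (++⁺)
open import Data.Nat using (ℕ; zero; suc; _+_; _*_; _∸_; _≡ᵇ_; _≤ᵇ_; _≤_; _<_; z≤n; s≤s)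
open import Data.Nat.ListAction using (sum)
open import Data.Nat.Properties
  using (≡ᵇ⇒≡; ≡⇒≡ᵇ; ≤⇒≤ᵇ; ≤ᵇ⇒≤; <⇒≱; <⇒≢; >⇒≢; <⇒≤; ≤-pred; ≤-refl; ≤-reflexive; ≤-trans; <-≤-trans;
         m<n⇒m<1+n; m≤m+n; m<m+n; +-identityʳ; +-suc; +-assoc; +-comm; *-zeroʳ; m∸n+n≡m; suc-injective)
open import Data.Nat.Tactic.RingSolver using (solve-∀)
open import Data.Product using (_×_; _,_)
open import Data.Unit using (⊤; tt)
open import Function using (_∘_)
open import Function.Bundles using (Equivalence)
open import Relation.Nullary using (¬_)
open import Relation.Binary.PropositionalEquality
open import Defs

countTrue-++ : {A : Set} (p : A → Bool) (xs ys : List A) →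
               countTrue p (xs ++ ys) ≡ countTrue p xs + countTrue p ys
countTrue-++ p []       ys = refl
countTrue-++ p (x ∷ xs) ys with p x
... | true  = cong suc (countTrue-++ p xs ys)
... | false = countTrue-++ p xs ys

countTrue-map : {A B : Set} (p : B → Bool) (f : A → B) (xs : List A) →
                countTrue p (map f xs) ≡ countTrue (p ∘ f) xs
countTrue-map p f []       = refl
countTrue-map p f (x ∷ xs) with p (f x)
... | true  = cong suc (countTrue-map p f xs)
... | false = countTrue-map p f xs

countTrue-cong : {A : Set} {p q : A → Bool} → (∀ x → p x ≡ q x) → (xs : List A) →
                 countTrue p xs ≡ countTrue q xs
countTrue-cong p≗q []       = refl
countTrue-cong {q = q} p≗q (x ∷ xs) rewrite p≗q x with q x
... | true  = cong suc (countTrue-cong p≗q xs)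
... | false = countTrue-cong p≗q xs

countTrue-false : {A : Set} (xs : List A) → countTrue (λ _ → false) xs ≡ 0
countTrue-false []       = refl
countTrue-false (x ∷ xs) = countTrue-false xs

countTrue-∧ˡ : {A : Set} (c : Bool) (q : A → Bool) (xs : List A) →
               countTrue (λ x → c ∧ q x) xs ≡ (if c then countTrue q xs else 0)
countTrue-∧ˡ true  q xs = refl
countTrue-∧ˡ false q xs = countTrue-false xs

allB-∧ : {A : Set} (p q : A → Bool) (xs : List A) →
         allB (λ x → p x ∧ q x) xs ≡ allB p xs ∧ allB q xs
allB-∧ p q []       = refl
allB-∧ p q (x ∷ xs) rewrite allB-∧ p q xs = ∧-interchange (p x) (q x) (allB p xs) (allB q xs)

allB-true : {A : Set} (xs : List A) → allB (λ _ → true) xs ≡ true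
allB-true []       = refl
allB-true (x ∷ xs) = allB-true xs

module Independence {A : Set} (adj : A → A → Bool) where

  independent : List A → Bool
  independent S = allB (λ u → allB (λ v → not (adj u v)) S) S

  compatible : A → A → Bool
  compatible x y = not (adj x y) ∧ not (adj y x)

  indepCount : (A → Bool) → List A → ℕ
  indepCountWith : (A → Bool) → A → List A → ℕ

  indepCount ok []      = 1
  indepCount ok (x ∷ L) = indepCountWith ok x L + indepCount ok L

  indepCountWith ok x L = if ok x ∧ not (adj x x) then indepCount (λ y → ok y ∧ compatible x y) L else 0

  private
    ∧-shuffle : ∀ o A n B C I → (o ∧ A) ∧ ((n ∧ B) ∧ (C ∧ I)) ≡ (o ∧ n) ∧ ((A ∧ (B ∧ C)) ∧ I)
    ∧-shuffle false A     n     B     C     I = refl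
    ∧-shuffle true  false false B     C     I = refl
    ∧-shuffle true  false true  false C     I = refl
    ∧-shuffle true  false true  true  false I = refl
    ∧-shuffle true  false true  true  true  I = refl
    ∧-shuffle true  true  false B     C     I = refl
    ∧-shuffle true  true  true  false C     I = refl
    ∧-shuffle true  true  true  true  false I = refl
    ∧-shuffle true  true  true  true  true  I = refl

  allB-independent-∷ : (ok : A → Bool) (x : A) (S : List A) →
    allB ok (x ∷ S) ∧ independent (x ∷ S) ≡
    (ok x ∧ not (adj x x)) ∧ (allB (λ y → ok y ∧ compatible x y) S ∧ independent S)
  allB-independent-∷ ok x S
    rewrite allB-∧ (λ u → not (adj u x)) (λ u → allB (λ v → not (adj u v)) S) S
          | allB-∧ ok (compatible x) S
          | allB-∧ (λ y → not (adj x y)) (λ y → not (adj y x)) S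
    = ∧-shuffle (ok x) (allB ok S) (not (adj x x)) (allB (λ v → not (adj x v)) S)
                (allB (λ u → not (adj u x)) S) (independent S)

  countTrue-subsets≡indepCount : (ok : A → Bool) (L : List A) →
    countTrue (λ S → allB ok S ∧ independent S) (subsets L) ≡ indepCount ok L
  countTrue-subsets≡indepCount ok []      = refl
  countTrue-subsets≡indepCount ok (x ∷ L) = begin
      countTrue isOk (map (x ∷_) (subsets L) ++ subsets L)
    ≡⟨ countTrue-++ isOk (map (x ∷_) (subsets L)) (subsets L) ⟩
      countTrue isOk (map (x ∷_) (subsets L)) + countTrue isOk (subsets L)
    ≡⟨ cong₂ _+_ containing-x (countTrue-subsets≡indepCount ok L) ⟩
      indepCountWith ok x L + indepCount ok L ∎
    where
    open ≡-Reasoning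
    isOk : List A → Bool
    isOk S = allB ok S ∧ independent S

    restrictedCount : (c : Bool) →
      (if c then countTrue (λ S → allB (λ y → ok y ∧ compatible x y) S ∧ independent S) (subsets L) else 0) ≡
      (if c then indepCount (λ y → ok y ∧ compatible x y) L else 0)
    restrictedCount true  = countTrue-subsets≡indepCount _ L
    restrictedCount false = refl

    containing-x : countTrue isOk (map (x ∷_) (subsets L)) ≡ indepCountWith ok x L
    containing-x = begin
        countTrue isOk (map (x ∷_) (subsets L))
      ≡⟨ countTrue-map isOk (x ∷_) (subsets L) ⟩
        countTrue (isOk ∘ (x ∷_)) (subsets L)
      ≡⟨ countTrue-cong (allB-independent-∷ ok x) (subsets L) ⟩
        countTrue (λ S → (ok x ∧ not (adj x x)) ∧ (allB (λ y → ok y ∧ compatible x y) S ∧ independent S)) (subsets L)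
      ≡⟨ countTrue-∧ˡ (ok x ∧ not (adj x x)) _ (subsets L) ⟩
        _
      ≡⟨ restrictedCount (ok x ∧ not (adj x x)) ⟩
        indepCountWith ok x L ∎

  countTrue-independent≡indepCount : (L : List A) → countTrue independent (subsets L) ≡ indepCount (λ _ → true) L
  countTrue-independent≡indepCount L =
    trans (countTrue-cong (λ S → cong (_∧ independent S) (sym (allB-true S))) (subsets L))
          (countTrue-subsets≡indepCount (λ _ → true) L)

  indepCount-cong : {ok ok′ : A → Bool} (L : List A) → All (λ y → ok y ≡ ok′ y) L →
                    indepCount ok L ≡ indepCount ok′ L
  indepCount-cong []      []       = refl
  indepCount-cong {ok′ = ok′} (x ∷ L) (e ∷ es) rewrite e =
    cong₂ _+_ (cong (λ c → if ok′ x ∧ not (adj x x) then c else 0)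
                    (indepCount-cong L (All.map (cong (_∧ compatible x _)) es)))
              (indepCount-cong L es)

  indepCount-++-forbidden : (ok : A → Bool) (B R : List A) → All (λ y → ok y ≡ false) B →
                            indepCount ok (B ++ R) ≡ indepCount ok R
  indepCount-++-forbidden ok []      R []       = refl
  indepCount-++-forbidden ok (x ∷ B) R (e ∷ es) rewrite e = indepCount-++-forbidden ok B R es

  indepCountWith-++-incompatible : (ok : A → Bool) (x : A) (B R : List A) →
    All (λ y → compatible x y ≡ false) B → indepCountWith ok x (B ++ R) ≡ indepCountWith ok x R
  indepCountWith-++-incompatible ok x B R incompatible with ok x ∧ not (adj x x)
  ... | true  = indepCount-++-forbidden _ B R
                  (All.map (λ {y} e → trans (cong (ok y ∧_) e) (∧-zeroʳ (ok y))) incompatible)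
  ... | false = refl

  IsClique : List A → Set
  IsClique []      = ⊤
  IsClique (x ∷ B) = All (λ y → compatible x y ≡ false) B × IsClique B

  -- an independent set meets a clique in at most one vertex
  indepCount-clique-++ : (ok : A → Bool) (B R : List A) → IsClique B →
    indepCount ok (B ++ R) ≡ sum (map (λ x → indepCountWith ok x R) B) + indepCount ok R
  indepCount-clique-++ ok []      R _                  = refl
  indepCount-clique-++ ok (x ∷ B) R (x-incompatible , clique) = begin
      indepCountWith ok x (B ++ R) + indepCount ok (B ++ R)
    ≡⟨ cong₂ _+_ (indepCountWith-++-incompatible ok x B R x-incompatible)
                 (indepCount-clique-++ ok B R clique) ⟩
      indepCountWith ok x R + (sum (map (λ y → indepCountWith ok y R) B) + indepCount ok R)
    ≡⟨ sym (+-assoc (indepCountWith ok x R) _ _) ⟩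
      sum (map (λ y → indepCountWith ok y R) (x ∷ B)) + indepCount ok R ∎
    where open ≡-Reasoning

i≡indepCount : (G : Graph) → i G ≡ Independence.indepCount (adj G) (λ _ → true) (vertices G)
i≡indepCount G = Independence.countTrue-independent≡indepCount (adj G) (vertices G)

Uℕ : ℕ → ℕ → ℕ → ℕ
Uℕ a b zero          = 0
Uℕ a b (suc zero)    = 1
Uℕ a b (suc (suc k)) = a * Uℕ a b (suc k) + b * Uℕ a b k

Vℕ : ℕ → ℕ → ℕ → ℕ
Vℕ a b zero          = 2
Vℕ a b (suc zero)    = a
Vℕ a b (suc (suc k)) = a * Vℕ a b (suc k) + b * Vℕ a b k

lucas-step-neg : ∀ a b x y → + a ℤ.* + x ℤ.- (- + b) ℤ.* + y ≡ + (a * x + b * y)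
lucas-step-neg a b x y = begin
    + a ℤ.* + x ℤ.+ - (- + b ℤ.* + y)
  ≡⟨ cong (λ t → + a ℤ.* + x ℤ.+ - t) (sym (ℤ.neg-distribˡ-* (+ b) (+ y))) ⟩
    + a ℤ.* + x ℤ.+ - - (+ b ℤ.* + y)
  ≡⟨ cong (λ t → + a ℤ.* + x ℤ.+ t) (ℤ.neg-involutive _) ⟩
    + a ℤ.* + x ℤ.+ + b ℤ.* + y
  ≡⟨ cong₂ ℤ._+_ (sym (ℤ.pos-* a x)) (sym (ℤ.pos-* b y)) ⟩
    + (a * x) ℤ.+ + (b * y)
  ≡⟨ sym (ℤ.pos-+ (a * x) (b * y)) ⟩
    + (a * x + b * y) ∎
  where open ≡-Reasoning

U-neg : ∀ a b k → U k (+ a) (- + b) ≡ + Uℕ a b k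
U-neg a b zero          = refl
U-neg a b (suc zero)    = refl
U-neg a b (suc (suc k)) rewrite U-neg a b (suc k) | U-neg a b k =
  lucas-step-neg a b (Uℕ a b (suc k)) (Uℕ a b k)

V′-neg : ∀ a b k → V' k (+ a) (- + b) ≡ + Vℕ a b k
V′-neg a b zero          = refl
V′-neg a b (suc zero)    = refl
V′-neg a b (suc (suc k)) rewrite V′-neg a b (suc k) | V′-neg a b k =
  lucas-step-neg a b (Vℕ a b (suc k)) (Vℕ a b k)

Vℕ-suc : ∀ a b k → Vℕ a b (suc k) ≡ Uℕ a b (suc (suc k)) + b * Uℕ a b k
Vℕ-suc a b zero          = base a b
  where
  base : ∀ a b → a ≡ (a * 1 + b * 0) + b * 0
  base = solve-∀
Vℕ-suc a b (suc zero)    = base a b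
  where
  base : ∀ a b → a * a + b * 2 ≡ (a * (a * 1 + b * 0) + b * 1) + b * 1
  base = solve-∀
Vℕ-suc a b (suc (suc k)) = begin
    a * Vℕ a b (suc (suc k)) + b * Vℕ a b (suc k)
  ≡⟨ cong₂ (λ x y → a * x + b * y) (Vℕ-suc a b (suc k)) (Vℕ-suc a b k) ⟩
    a * (u₃ + b * u₁) + b * (u₂ + b * u₀)
  ≡⟨ regroup a b u₃ u₁ u₀ ⟩
    (a * u₃ + b * u₂) + b * u₂ ∎
  where
  open ≡-Reasoning
  u₀ = Uℕ a b k
  u₁ = Uℕ a b (suc k)
  u₂ = Uℕ a b (suc (suc k))
  u₃ = Uℕ a b (suc (suc (suc k)))
  regroup : ∀ a b x y z → a * (x + b * y) + b * ((a * y + b * z) + b * z) ≡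
                          (a * x + b * (a * y + b * z)) + b * (a * y + b * z)
  regroup = solve-∀

≡ᵇ-refl : ∀ n → (n ≡ᵇ n) ≡ true
≡ᵇ-refl n = Equivalence.to T-≡ (≡⇒≡ᵇ n n refl)

¬T⇒≡false : ∀ {x} → ¬ T x → x ≡ false
¬T⇒≡false {false} _  = refl
¬T⇒≡false {true}  ¬t = ⊥-elim (¬t tt)

≢⇒≡ᵇ-false : ∀ {m n} → m ≢ n → (m ≡ᵇ n) ≡ false
≢⇒≡ᵇ-false {m} {n} m≢n = ¬T⇒≡false (m≢n ∘ ≡ᵇ⇒≡ m n)

≡ᵇ-+ʳ : ∀ m n → (m ≡ᵇ m + n) ≡ (n ≡ᵇ 0)
≡ᵇ-+ʳ zero    zero    = refl
≡ᵇ-+ʳ zero    (suc n) = refl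
≡ᵇ-+ʳ (suc m) n       = ≡ᵇ-+ʳ m n

≤⇒≤ᵇ-true : ∀ {m n} → m ≤ n → (m ≤ᵇ n) ≡ true
≤⇒≤ᵇ-true m≤n = Equivalence.to T-≡ (≤⇒≤ᵇ m≤n)

>⇒≤ᵇ-false : ∀ {m n} → n < m → (m ≤ᵇ n) ≡ false
>⇒≤ᵇ-false {m} {n} n<m = ¬T⇒≡false (<⇒≱ n<m ∘ ≤ᵇ⇒≤ m n)

if-cong : ∀ {c c′ : Bool} {x y : ℕ} → c ≡ c′ → x ≡ y → (if c then x else 0) ≡ (if c′ then y else 0)
if-cong refl refl = refl

thresholdSum : ℕ → (Bool → ℕ) → ℕ → ℕ → ℕ
thresholdSum t g j zero    = 0
thresholdSum t g j (suc c) = g (j ≤ᵇ t) + thresholdSum t g (suc j) c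

thresholdSum-above : ∀ t g {j} c → t < j → thresholdSum t g j c ≡ c * g false
thresholdSum-above t g zero    t<j = refl
thresholdSum-above t g (suc c) t<j rewrite >⇒≤ᵇ-false t<j =
  cong (λ s → g false + s) (thresholdSum-above t g c (m<n⇒m<1+n t<j))

thresholdSum-from : ∀ t g j x c → j + x ≡ t → thresholdSum t g (suc j) (x + c) ≡ x * g true + c * g false
thresholdSum-from t g j zero    c j+0≡t =
  thresholdSum-above t g c (s≤s (≤-reflexive (trans (sym j+0≡t) (+-identityʳ j))))
thresholdSum-from t g j (suc x) c j+x≡t
  rewrite ≤⇒≤ᵇ-true (subst (suc j ≤_) j+x≡t (≤-trans (s≤s (m≤m+n j x)) (≤-reflexive (sym (+-suc j x))))) = begin
    g true + thresholdSum t g (suc (suc j)) (x + c)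
  ≡⟨ cong (λ s → g true + s) (thresholdSum-from t g (suc j) x c (trans (sym (+-suc j x)) j+x≡t)) ⟩
    g true + (x * g true + c * g false)
  ≡⟨ sym (+-assoc (g true) (x * g true) (c * g false)) ⟩
    suc x * g true + c * g false ∎
  where open ≡-Reasoning

blades : ℕ → ℕ → ℕ → List (ℕ × ℕ)
blades v l zero    = []
blades v l (suc c) = (v , l) ∷ blades v (suc l) c

All-blades : ∀ {P : ℕ × ℕ → Set} v l c → (∀ l′ → l ≤ l′ → P (v , l′)) → All P (blades v l c)
All-blades v l zero    h = []
All-blades v l (suc c) h = h l ≤-refl ∷ All-blades v (suc l) c (λ l′ l<l′ → h l′ (<⇒≤ l<l′))

map-applyUpTo≡blades : ∀ v (f : ℕ → ℕ) l c → (∀ x → f x ≡ l + x) → map (v ,_) (applyUpTo f c) ≡ blades v l c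
map-applyUpTo≡blades v f l zero    f≗l+ = refl
map-applyUpTo≡blades v f l (suc c) f≗l+ =
  cong₂ _∷_ (cong (v ,_) (trans (f≗l+ 0) (+-identityʳ l)))
            (map-applyUpTo≡blades v (f ∘ suc) (suc l) c (λ x → trans (f≗l+ (suc x)) (+-suc l x)))

sum-map-blades : ∀ t (f : ℕ × ℕ → ℕ) (g : Bool → ℕ) v j c → (∀ l → f (v , suc l) ≡ g (suc l ≤ᵇ t)) →
                 sum (map f (blades v (suc j) c)) ≡ thresholdSum t g (suc j) c
sum-map-blades t f g v j zero    f≗g = refl
sum-map-blades t f g v j (suc c) f≗g = cong₂ _+_ (f≗g j) (sum-map-blades t f g v (suc j) c f≗g)

arc : ℕ → ℕ → ℕ → ℕ × ℕ → ℕ × ℕ → Bool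
arc n a b (u , k) (v , l) = (k ≡ᵇ 0) ∧ (l ≤ᵇ a ∸ b) ∧ (v ≡ᵇ sucMod n u)

chainsawAdj-distinct : ∀ n a b {u v} k l → u ≢ v →
  chainsawAdj n a b (u , k) (v , l) ≡ arc n a b (u , k) (v , l) ∨ arc n a b (v , l) (u , k)
chainsawAdj-distinct n a b zero    zero    u≢v rewrite ≢⇒≡ᵇ-false u≢v = ∨-identityʳ _
chainsawAdj-distinct n a b zero    (suc l) u≢v rewrite ≢⇒≡ᵇ-false u≢v = refl
chainsawAdj-distinct n a b (suc k) zero    u≢v rewrite ≢⇒≡ᵇ-false u≢v = refl
chainsawAdj-distinct n a b (suc k) (suc l) u≢v rewrite ≢⇒≡ᵇ-false u≢v = refl

compatible-distinct : ∀ n a b {u v} k l → u ≢ v →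
  Independence.compatible (chainsawAdj n a b) (u , k) (v , l) ≡
  not (arc n a b (u , k) (v , l)) ∧ not (arc n a b (v , l) (u , k))
compatible-distinct n a b {u} {v} k l u≢v
  rewrite chainsawAdj-distinct n a b k l u≢v | chainsawAdj-distinct n a b l k (u≢v ∘ sym)
  = not-∨-∧-not-∨ (arc n a b (u , k) (v , l)) (arc n a b (v , l) (u , k))
  where
  not-∨-∧-not-∨ : ∀ x y → not (x ∨ y) ∧ not (y ∨ x) ≡ not x ∧ not y
  not-∨-∧-not-∨ true  y     = refl
  not-∨-∧-not-∨ false true  = refl
  not-∨-∧-not-∨ false false = refl

chainsawAdj-same-clique : ∀ n a b v {k l} → k ≢ l → chainsawAdj n a b (v , k) (v , l) ≡ true
chainsawAdj-same-clique n a b v k≢l rewrite ≡ᵇ-refl v | ≢⇒≡ᵇ-false k≢l = refl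

chainsawAdj-blade-irreflexive : ∀ n a b v l → chainsawAdj n a b (v , suc l) (v , suc l) ≡ false
chainsawAdj-blade-irreflexive n a b v l rewrite ≡ᵇ-refl v | ≡ᵇ-refl l = refl

chainsawAdj-chain-loop : ∀ n a b v → chainsawAdj n a b (v , 0) (v , 0) ≡ (v ≡ᵇ sucMod n v)
chainsawAdj-chain-loop n a b v rewrite ≡ᵇ-refl v = trans (∨-identityʳ _) (∨-idem _)

sucMod-≢-last : ∀ m w → (w ≡ᵇ m) ≡ false → sucMod (suc m) w ≡ suc w
sucMod-≢-last m w w≢m rewrite w≢m = refl

zero≡ᵇsucMod : ∀ m w → (0 ≡ᵇ sucMod (suc m) w) ≡ (w ≡ᵇ m)
zero≡ᵇsucMod m w with w ≡ᵇ m
... | true  = refl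
... | false = refl

sucMod-≢ : ∀ m {v w} → 1 ≤ v → v ≤ w → (v ≡ᵇ sucMod (suc m) w) ≡ false
sucMod-≢ m {suc v} {w} _ v≤w with w ≡ᵇ m
... | true  = refl
... | false = ≢⇒≡ᵇ-false (<⇒≢ (s≤s v≤w))

module Chainsaw (m a′ b′ : ℕ) (b′≤a′ : b′ ≤ a′) where

  N a b d : ℕ
  N = suc m
  a = suc a′
  b = suc b′
  d = a ∸ b

  open Independence (chainsawAdj N a b)

  a′≡d+b′ : a′ ≡ d + b′
  a′≡d+b′ = sym (m∸n+n≡m b′≤a′)

  clique : ℕ → List (ℕ × ℕ)
  clique v = (v , 0) ∷ blades v 1 a′

  blocks : ℕ → ℕ → List (ℕ × ℕ)
  blocks v zero    = []
  blocks v (suc k) = clique v ++ blocks (suc v) k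

  All-blocks : ∀ {P : ℕ × ℕ → Set} v k → (∀ w l → v ≤ w → w < v + k → P (w , l)) → All P (blocks v k)
  All-blocks v zero    h = []
  All-blocks v (suc k) h =
    ++⁺ (h v 0 ≤-refl v<v+1+k ∷ All-blades v 1 a′ (λ l _ → h v l ≤-refl v<v+1+k))
        (All-blocks (suc v) k (λ w l v<w w<1+v+k → h w l (<⇒≤ v<w) (≤-trans w<1+v+k (≤-reflexive (sym (+-suc v k))))))
    where
    v<v+1+k = m<m+n v (s≤s z≤n)

  map-upTo≡clique : ∀ v → map (v ,_) (upTo a) ≡ clique v
  map-upTo≡clique v = cong ((v , 0) ∷_) (map-applyUpTo≡blades v suc 1 a′ (λ _ → refl))

  cartesianProduct≡blocks : ∀ (f : ℕ → ℕ) v k → (∀ x → f x ≡ v + x) →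
                            cartesianProductWith _,_ (applyUpTo f k) (upTo a) ≡ blocks v k
  cartesianProduct≡blocks f v zero    f≗v+ = refl
  cartesianProduct≡blocks f v (suc k) f≗v+ =
    cong₂ _++_ (trans (cong (λ w → map (w ,_) (upTo a)) (trans (f≗v+ 0) (+-identityʳ v))) (map-upTo≡clique v))
               (cartesianProduct≡blocks (f ∘ suc) (suc v) k (λ x → trans (f≗v+ (suc x)) (+-suc v x)))

  vertices-C : vertices (C N a b) ≡ blocks 0 N
  vertices-C = cartesianProduct≡blocks (λ x → x) 0 N (λ _ → refl)

  vertices-P : vertices (P m a b) ≡ blades 0 1 a′ ++ blocks 1 m
  vertices-P = begin
      filter? (chainsawVertices N a)
    ≡⟨ cong filter? vertices-C ⟩
      filter? (clique 0 ++ blocks 1 m)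
    ≡⟨ filter-++ notChain0? (clique 0) (blocks 1 m) ⟩
      filter? (blades 0 1 a′) ++ filter? (blocks 1 m)
    ≡⟨ cong₂ _++_ (filter-all notChain0? (All-blades 0 1 a′ (λ { (suc l) _ → refl })))
                  (filter-all notChain0? (All-blocks 1 m (λ { (suc w) l _ _ → refl }))) ⟩
      blades 0 1 a′ ++ blocks 1 m ∎
    where
    open ≡-Reasoning
    notChain0? = λ x → not (isChain0 x) Bool.≟ true
    filter? = filter notChain0?

  compatible-same-clique : ∀ v {k l} → k ≢ l → compatible (v , k) (v , l) ≡ false
  compatible-same-clique v k≢l rewrite chainsawAdj-same-clique N a b v k≢l = refl

  blades-isClique : ∀ v l c → IsClique (blades v l c)
  blades-isClique v l zero    = tt
  blades-isClique v l (suc c) =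
    All-blades v (suc l) c (λ l′ l<l′ → compatible-same-clique v (<⇒≢ l<l′)) , blades-isClique v (suc l) c

  clique-isClique : ∀ v → IsClique (clique v)
  clique-isClique v =
    All-blades v 1 a′ (λ l′ 0<l′ → compatible-same-clique v (<⇒≢ 0<l′)) , blades-isClique v 1 a′

  -- allowed v p e y: y is not excluded by an independent set chosen from the blocks before v,
  -- where p records that chain vertex v - 1 was chosen (excluding chain vertex v and the
  -- first d blade vertices of its clique) and e that chain vertex m is excluded (being
  -- adjacent to the vertex chosen in the clique of 0).
  allowed : ℕ → Bool → Bool → ℕ × ℕ → Bool
  allowed v p e (w , l) = not (p ∧ (l ≤ᵇ d) ∧ (w ≡ᵇ v)) ∧ not ((l ≡ᵇ 0) ∧ e ∧ (w ≡ᵇ m))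

  allowed-free : ∀ v w l → allowed v false false (w , l) ≡ true
  allowed-free v w l rewrite ∧-zeroʳ (l ≡ᵇ 0) = refl

  allowed-later : ∀ {v w} p e l → v < w → allowed v p e (w , l) ≡ allowed (suc v) false e (w , l)
  allowed-later {v} {w} p e l v<w rewrite ≢⇒≡ᵇ-false (>⇒≢ v<w) | ∧-zeroʳ (l ≤ᵇ d) | ∧-zeroʳ p = refl

  arc-backward : ∀ {v w} l j → 1 ≤ v → v < w → arc N a b (w , l) (v , j) ≡ false
  arc-backward l j 1≤v v<w rewrite sucMod-≢ m 1≤v (<⇒≤ v<w) | ∧-zeroʳ (j ≤ᵇ d) | ∧-zeroʳ (l ≡ᵇ 0) = refl

  allowed-after-chain : ∀ {v w} p e l → 1 ≤ v → v < w → w ≤ m →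
    allowed v p e (w , l) ∧ compatible (v , 0) (w , l) ≡ allowed (suc v) true e (w , l)
  allowed-after-chain {v} {w} p e l 1≤v v<w w≤m
    rewrite allowed-later p e l v<w
          | compatible-distinct N a b 0 l (<⇒≢ v<w)
          | arc-backward l 0 1≤v v<w
          | sucMod-≢-last m v (≢⇒≡ᵇ-false (<⇒≢ (<-≤-trans v<w w≤m)))
          | ∧-identityʳ (not ((l ≤ᵇ d) ∧ (w ≡ᵇ suc v)))
    = ∧-comm (not ((l ≡ᵇ 0) ∧ e ∧ (w ≡ᵇ m))) (not ((l ≤ᵇ d) ∧ (w ≡ᵇ suc v)))

  allowed-after-blade : ∀ {v w} p e l j → 1 ≤ v → v < w →
    allowed v p e (w , l) ∧ compatible (v , suc j) (w , l) ≡ allowed (suc v) false e (w , l)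
  allowed-after-blade {v} {w} p e l j 1≤v v<w
    rewrite compatible-distinct N a b (suc j) l (<⇒≢ v<w)
          | arc-backward l (suc j) 1≤v v<w
          | ∧-identityʳ (allowed v p e (w , l))
    = allowed-later p e l v<w

  compatible-first-chain : ∀ {w} l → (0 ≡ᵇ m) ≡ false → 1 ≤ w → compatible (0 , 0) (w , l) ≡ allowed 1 true true (w , l)
  compatible-first-chain {w} l 0≢m 1≤w
    rewrite compatible-distinct N a b 0 l (<⇒≢ 1≤w) | sucMod-≢-last m 0 0≢m | zero≡ᵇsucMod m w
    = refl

  compatible-first-blade : ∀ {w} l j → 1 ≤ w → compatible (0 , suc j) (w , l) ≡ allowed 1 false (suc j ≤ᵇ d) (w , l)
  compatible-first-blade {w} l j 1≤w
    rewrite compatible-distinct N a b (suc j) l (<⇒≢ 1≤w) | zero≡ᵇsucMod m w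
    = refl

  -- tailCount k p e counts the independent sets of the last k blocks satisfying allowed _ p e;
  -- in the second clause the current block is the last one (that of chain vertex m) iff k = 0.
  tailCount : ℕ → Bool → Bool → ℕ
  tailCount zero    p e = 1
  tailCount (suc k) p e =
    (if not p ∧ not (e ∧ (k ≡ᵇ 0)) then tailCount k true e else 0) + (if p then b else a) * tailCount k false e

  CountsTail : ℕ → ℕ → Set
  CountsTail k v = ∀ p e (ok : ℕ × ℕ → Bool) → All (λ y → ok y ≡ allowed v p e y) (blocks v k) →
                   indepCount ok (blocks v k) ≡ tailCount k p e

  module _ {v k : ℕ} (1≤v : 1 ≤ v) (v+k≡m : v + k ≡ m) (countsTail-next : CountsTail k (suc v)) (p e : Bool) where

    count-with-chain : indepCountWith (allowed v p e) (v , 0) (blocks (suc v) k) ≡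
                       (if not p ∧ not (e ∧ (k ≡ᵇ 0)) then tailCount k true e else 0)
    count-with-chain = if-cong condition (countsTail-next true e _ (All-blocks (suc v) k
      (λ w l v<w w<1+v+k → allowed-after-chain p e l 1≤v v<w (subst (w ≤_) v+k≡m (≤-pred w<1+v+k)))))
      where
      condition : allowed v p e (v , 0) ∧ not (chainsawAdj N a b (v , 0) (v , 0)) ≡ not p ∧ not (e ∧ (k ≡ᵇ 0))
      condition
        rewrite chainsawAdj-chain-loop N a b v | sucMod-≢ m 1≤v ≤-refl | ≡ᵇ-refl v | ∧-identityʳ p
              | sym v+k≡m | ≡ᵇ-+ʳ v k
        = ∧-identityʳ _

    count-with-blade : ∀ j → indepCountWith (allowed v p e) (v , suc j) (blocks (suc v) k) ≡
                             (if not (p ∧ (suc j ≤ᵇ d)) then tailCount k false e else 0)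
    count-with-blade j = if-cong condition (countsTail-next false e _ (All-blocks (suc v) k
      (λ w l v<w _ → allowed-after-blade p e l j 1≤v v<w)))
      where
      condition : allowed v p e (v , suc j) ∧ not (chainsawAdj N a b (v , suc j) (v , suc j)) ≡ not (p ∧ (suc j ≤ᵇ d))
      condition rewrite chainsawAdj-blade-irreflexive N a b v j | ≡ᵇ-refl v | ∧-identityʳ (suc j ≤ᵇ d)
        = trans (∧-identityʳ _) (∧-identityʳ _)

    count-without : indepCount (allowed v p e) (blocks (suc v) k) ≡ tailCount k false e
    count-without = countsTail-next false e _ (All-blocks (suc v) k (λ w l v<w _ → allowed-later p e l v<w))

  sum-blades : ∀ v (f : ℕ × ℕ → ℕ) (g : Bool → ℕ) → (∀ j → f (v , suc j) ≡ g (suc j ≤ᵇ d)) →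
               sum (map f (blades v 1 a′)) ≡ d * g true + b′ * g false
  sum-blades v f g f≗g = trans (sum-map-blades d f g v 0 a′ f≗g)
    (subst (λ c → thresholdSum d g 1 c ≡ d * g true + b′ * g false) (sym a′≡d+b′) (thresholdSum-from d g 0 d b′ refl))

  tailCount-suc : ∀ k p e → let g = λ t → if not (p ∧ t) then tailCount k false e else 0 in
    ((if not p ∧ not (e ∧ (k ≡ᵇ 0)) then tailCount k true e else 0) + (d * g true + b′ * g false)) + tailCount k false e
    ≡ tailCount (suc k) p e
  tailCount-suc k true  e = regroup d b′ (tailCount k false e)
    where
    regroup : ∀ d b′ t → (0 + (d * 0 + b′ * t)) + t ≡ t + b′ * t
    regroup = solve-∀
  tailCount-suc k false e = trans (regroup c d b′ t) (cong (λ s → c + suc s * t) (sym a′≡d+b′))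
    where
    c = if not (e ∧ (k ≡ᵇ 0)) then tailCount k true e else 0
    t = tailCount k false e
    regroup : ∀ c d b′ t → (c + (d * t + b′ * t)) + t ≡ c + (t + (d + b′) * t)
    regroup = solve-∀

  countsTail : ∀ k v → 1 ≤ v → v + k ≡ N → CountsTail k v
  countsTail zero    v _   _     p e ok _     = refl
  countsTail (suc k) v 1≤v v+k≡N p e ok agree = begin
      indepCount ok (clique v ++ rest)
    ≡⟨ indepCount-cong (clique v ++ rest) agree ⟩
      indepCount (allowed v p e) (clique v ++ rest)
    ≡⟨ indepCount-clique-++ (allowed v p e) (clique v) rest (clique-isClique v) ⟩
      (indepCountWith (allowed v p e) (v , 0) rest + sum (map (λ x → indepCountWith (allowed v p e) x rest) (blades v 1 a′)))
        + indepCount (allowed v p e) rest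
    ≡⟨ cong₂ _+_ (cong₂ _+_ (count-with-chain 1≤v v+k≡m next p e)
                            (sum-blades v _ (λ t → if not (p ∧ t) then tailCount k false e else 0) (count-with-blade 1≤v v+k≡m next p e)))
                 (count-without 1≤v v+k≡m next p e) ⟩
      _
    ≡⟨ tailCount-suc k p e ⟩
      tailCount (suc k) p e ∎
    where
    open ≡-Reasoning
    rest = blocks (suc v) k
    1+v+k≡N = trans (sym (+-suc v k)) v+k≡N
    v+k≡m = suc-injective 1+v+k≡N
    next = countsTail k (suc v) (s≤s z≤n) 1+v+k≡N

  tailCount-false-true : ∀ k → tailCount k false true ≡ Uℕ a b (suc k)
  tailCount-false-true zero          = refl
  tailCount-false-true (suc zero)    = regroup a b
    where
    regroup : ∀ a b → 0 + a * 1 ≡ a * 1 + b * 0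
    regroup = solve-∀
  tailCount-false-true (suc (suc k)) =
    trans (cong₂ (λ x y → (0 + b * y) + a * x) (tailCount-false-true (suc k)) (tailCount-false-true k))
          (regroup a b (Uℕ a b (suc (suc k))) (Uℕ a b (suc k)))
    where
    regroup : ∀ a b x y → (0 + b * y) + a * x ≡ a * x + b * y
    regroup = solve-∀

  tailCount-false-false : ∀ k → tailCount k false false ≡ Uℕ a b (suc k) + Uℕ a b k
  tailCount-false-false zero          = refl
  tailCount-false-false (suc zero)    = regroup a b
    where
    regroup : ∀ a b → 1 + a * 1 ≡ (a * 1 + b * 0) + 1
    regroup = solve-∀
  tailCount-false-false (suc (suc k)) =
    trans (cong₂ (λ x y → (0 + b * y) + a * x) (tailCount-false-false (suc k)) (tailCount-false-false k))
          (regroup a b (Uℕ a b (suc (suc k))) (Uℕ a b (suc k)) (Uℕ a b k))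
    where
    regroup : ∀ a b x y z → (0 + b * (y + z)) + a * (x + y) ≡ (a * x + b * y) + (a * y + b * z)
    regroup = solve-∀

  tailCount-true-true : ∀ k → (0 ≡ᵇ k) ≡ false → tailCount k true true ≡ b * Uℕ a b k
  tailCount-true-true (suc k) _ = cong (b *_) (tailCount-false-true k)

  count-with-first-chain : indepCountWith (λ _ → true) (0 , 0) (blocks 1 m) ≡ b * Uℕ a b m
  count-with-first-chain = trans (if-cong condition refl) (by-cases (0 ≡ᵇ m) refl)
    where
    -- for m = 0 the cycle is a loop at chain vertex 0, which no independent set contains
    condition : not (chainsawAdj N a b (0 , 0) (0 , 0)) ≡ not (0 ≡ᵇ m)
    condition rewrite chainsawAdj-chain-loop N a b 0 | zero≡ᵇsucMod m 0 = refl

    by-cases : ∀ c → (0 ≡ᵇ m) ≡ c →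
               (if not c then indepCount (compatible (0 , 0)) (blocks 1 m) else 0) ≡ b * Uℕ a b m
    by-cases true  0≡ᵇm = sym (trans (cong (λ k → b * Uℕ a b k) (sym (≡ᵇ⇒≡ 0 m (subst T (sym 0≡ᵇm) tt))))
                                     (*-zeroʳ b))
    by-cases false 0≡ᵇm = trans (countsTail m 1 ≤-refl refl true true _
                                  (All-blocks 1 m (λ w l 1≤w _ → compatible-first-chain l 0≡ᵇm 1≤w)))
                                (tailCount-true-true m 0≡ᵇm)

  count-with-first-blades : sum (map (λ x → indepCountWith (λ _ → true) x (blocks 1 m)) (blades 0 1 a′)) ≡
                            d * Uℕ a b (suc m) + b′ * (Uℕ a b (suc m) + Uℕ a b m)
  count-with-first-blades =
    trans (sum-blades 0 _ (tailCount m false) count-with-first-blade)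
          (cong₂ (λ x y → d * x + b′ * y) (tailCount-false-true m) (tailCount-false-false m))
    where
    count-with-first-blade : ∀ j → indepCountWith (λ _ → true) (0 , suc j) (blocks 1 m) ≡ tailCount m false (suc j ≤ᵇ d)
    count-with-first-blade j rewrite chainsawAdj-blade-irreflexive N a b 0 j =
      countsTail m 1 ≤-refl refl false (suc j ≤ᵇ d) _
        (All-blocks 1 m (λ w l 1≤w _ → compatible-first-blade l j 1≤w))

  count-later-blocks : indepCount (λ _ → true) (blocks 1 m) ≡ Uℕ a b (suc m) + Uℕ a b m
  count-later-blocks =
    trans (countsTail m 1 ≤-refl refl false false _ (All-blocks 1 m (λ w l _ _ → sym (allowed-free 1 w l))))
          (tailCount-false-false m)

  count-blades-and-later : sum (map (λ x → indepCountWith (λ _ → true) x (blocks 1 m)) (blades 0 1 a′))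
                           + indepCount (λ _ → true) (blocks 1 m) ≡ Uℕ a b (suc (suc m))
  count-blades-and-later =
    trans (cong₂ _+_ count-with-first-blades count-later-blocks)
          (trans (regroup d b′ (Uℕ a b (suc m)) (Uℕ a b m))
                 (cong (λ s → suc s * Uℕ a b (suc m) + b * Uℕ a b m) (sym a′≡d+b′)))
    where
    regroup : ∀ d b′ x y → (d * x + b′ * (x + y)) + (x + y) ≡ suc (d + b′) * x + suc b′ * y
    regroup = solve-∀

  i-P : i (P m a b) ≡ Uℕ a b (suc (suc m))
  i-P = begin
      i (P m a b)
    ≡⟨ i≡indepCount (P m a b) ⟩
      indepCount (λ _ → true) (vertices (P m a b))
    ≡⟨ cong (indepCount (λ _ → true)) vertices-P ⟩
      indepCount (λ _ → true) (blades 0 1 a′ ++ blocks 1 m)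
    ≡⟨ indepCount-clique-++ (λ _ → true) (blades 0 1 a′) (blocks 1 m) (blades-isClique 0 1 a′) ⟩
      sum (map (λ x → indepCountWith (λ _ → true) x (blocks 1 m)) (blades 0 1 a′)) + indepCount (λ _ → true) (blocks 1 m)
    ≡⟨ count-blades-and-later ⟩
      Uℕ a b (suc (suc m)) ∎
    where open ≡-Reasoning

  i-C : i (C N a b) ≡ Vℕ a b N
  i-C = begin
      i (C N a b)
    ≡⟨ i≡indepCount (C N a b) ⟩
      indepCount (λ _ → true) (vertices (C N a b))
    ≡⟨ cong (indepCount (λ _ → true)) vertices-C ⟩
      indepCount (λ _ → true) (clique 0 ++ blocks 1 m)
    ≡⟨ indepCount-clique-++ (λ _ → true) (clique 0) (blocks 1 m) (clique-isClique 0) ⟩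
      (indepCountWith (λ _ → true) (0 , 0) (blocks 1 m) + bladesCount) + indepCount (λ _ → true) (blocks 1 m)
    ≡⟨ +-assoc (indepCountWith (λ _ → true) (0 , 0) (blocks 1 m)) bladesCount _ ⟩
      indepCountWith (λ _ → true) (0 , 0) (blocks 1 m) + (bladesCount + indepCount (λ _ → true) (blocks 1 m))
    ≡⟨ cong₂ _+_ count-with-first-chain count-blades-and-later ⟩
      b * Uℕ a b m + Uℕ a b (suc (suc m))
    ≡⟨ +-comm (b * Uℕ a b m) (Uℕ a b (suc (suc m))) ⟩
      Uℕ a b (suc (suc m)) + b * Uℕ a b m
    ≡⟨ sym (Vℕ-suc a b m) ⟩
      Vℕ a b N ∎
    where
    open ≡-Reasoning
    bladesCount = sum (map (λ x → indepCountWith (λ _ → true) x (blocks 1 m)) (blades 0 1 a′))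

theorem1p2 : (n a b : ℕ) → 1 ≤ n → 1 ≤ b → b ≤ a →
    (+ i (P n a b) ≡ U (n + 2) (+ a) (- (+ b))) × (+ i (C n a b) ≡ V' n (+ a) (- (+ b)))
theorem1p2 (suc n) (suc a′) (suc b′) _ _ (s≤s b′≤a′) =
    (begin
      + i (P (suc n) a b)                 ≡⟨ cong +_ (Chainsaw.i-P (suc n) a′ b′ b′≤a′) ⟩
      + Uℕ a b (suc (suc (suc n)))        ≡⟨ cong (λ k → + Uℕ a b (suc k)) (+-comm 2 n) ⟩
      + Uℕ a b (suc n + 2)                ≡⟨ sym (U-neg a b (suc n + 2)) ⟩
      U (suc n + 2) (+ a) (- (+ b))       ∎)
  , (begin
      + i (C (suc n) a b)                 ≡⟨ cong +_ (Chainsaw.i-C n a′ b′ b′≤a′) ⟩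
      + Vℕ a b (suc n)                    ≡⟨ sym (V′-neg a b (suc n)) ⟩
      V' (suc n) (+ a) (- (+ b))          ∎)
  where
  open ≡-Reasoning
  a = suc a′
  b = suc b′
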